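{- Let $G$ be a finite Cayley integral group. Then every subgroup of $G$ is also Cayley integral.
   Context: For a finite group $G$ with identity $1$ and a subset $S\subseteq G\setminus\{1\}$ with $S=S^{ -1}$, the undirected Cayley graph $Cay(G,S)$ has vertex set $G$, with vertices $a,b$ adjacent whenever $ab^{ -1}\in S$. A graph is integral if all eigenvalues of its adjacency matrix are integers. A finite group $G$ is called Cayley integral if $Cay(G,S)$ is integral for every such subset $S$. -}

module Defs where

open import Data.Nat using (ℕ; zero; suc)
open import Data.Nat as ℕ using ()
open import Data.Integer using (ℤ; +_; -_; _+_; _*_)
open import Data.List using (List; []; _∷_)
open import Data.Vec using (Vec; []; _∷_)
open import Data.Fin using (Fin; zero; suc; punchIn; toℕ)
open import Data.Bool using (Bool; true; false; T; if_then_else_)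
open import Data.Product using (∃; Σ; _×_)
open import Relation.Binary.PropositionalEquality using (_≡_)
open import Relation.Nullary using (¬_)
open import Function.Definitions using (Injective)

-- Polynomials over ℤ as coefficient lists (constant term first).

Poly : Set
Poly = List ℤ

coeff : Poly → ℕ → ℤ
coeff []       _       = + 0
coeff (a ∷ p)  zero    = a
coeff (a ∷ p)  (suc k) = coeff p k

-- Equality of polynomials: equal coefficients (ignores trailing zeros).
_≈P_ : Poly → Poly → Set
p ≈P q = ∀ k → coeff p k ≡ coeff q k

_+P_ : Poly → Poly → Poly
[]      +P q       = q
(a ∷ p) +P []      = a ∷ p
(a ∷ p) +P (b ∷ q) = (a + b) ∷ (p +P q)

scaleP : ℤ → Poly → Poly
scaleP c []      = []
scaleP c (a ∷ p) = (c * a) ∷ scaleP c p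

negP : Poly → Poly
negP = scaleP (- (+ 1))

_*P_ : Poly → Poly → Poly
[]      *P q = []
(a ∷ p) *P q = scaleP a q +P (+ 0 ∷ (p *P q))

constP : ℤ → Poly
constP c = c ∷ []

X : Poly
X = + 0 ∷ + 1 ∷ []

sumFin : ∀ {n} → (Fin n → Poly) → Poly
sumFin {zero}  f = []
sumFin {suc n} f = f zero +P sumFin (λ i → f (suc i))

signP : ℕ → Poly → Poly
signP zero          p = p
signP (suc zero)    p = negP p
signP (suc (suc k)) p = signP k p

det : ∀ n → (Fin n → Fin n → Poly) → Poly
det zero    M = constP (+ 1)
det (suc n) M =
  sumFin (λ j → signP (toℕ j)
    (M zero j *P det n (λ i k → M (suc i) (punchIn j k))))

charPoly : ∀ n → (Fin n → Fin n → ℤ) → Poly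
charPoly n A = det n (λ i j →
  (if isDiag i j then X else []) +P negP (constP (A i j)))
  where
  isDiag : ∀ {m} → Fin m → Fin m → Bool
  isDiag zero    zero    = true
  isDiag zero    (suc _) = false
  isDiag (suc _) zero    = false
  isDiag (suc i) (suc j) = isDiag i j

prodLinear : ∀ {n} → Vec ℤ n → Poly
prodLinear []       = constP (+ 1)
prodLinear (l ∷ ls) = (X +P negP (constP l)) *P prodLinear ls

-- A square integer matrix has all eigenvalues integral: its
-- characteristic polynomial is ∏ (x - λᵢ) with all λᵢ ∈ ℤ.
IntegralMatrix : ∀ n → (Fin n → Fin n → ℤ) → Set
IntegralMatrix n A = Σ (Vec ℤ n) λ ls → charPoly n A ≈P prodLinear ls

record FinGroup (n : ℕ) : Set where
  infixl 7 _∙_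
  field
    _∙_       : Fin n → Fin n → Fin n
    e         : Fin n
    _⁻¹       : Fin n → Fin n
    assoc     : ∀ x y z → (x ∙ y) ∙ z ≡ x ∙ (y ∙ z)
    identityˡ : ∀ x → e ∙ x ≡ x
    identityʳ : ∀ x → x ∙ e ≡ x
    inverseˡ  : ∀ x → (x ⁻¹) ∙ x ≡ e
    inverseʳ  : ∀ x → x ∙ (x ⁻¹) ≡ e

Subset : ℕ → Set
Subset n = Fin n → Bool

module _ {n : ℕ} (G : FinGroup n) where
  open FinGroup G

  IsSubgroup : Subset n → Set
  IsSubgroup H =
    T (H e) × ((∀ x y → T (H x) → T (H y) → T (H (x ∙ y)))
              × (∀ x → T (H x) → T (H (x ⁻¹))))

  cayleyAdj : ∀ {m} → Subset n → (Fin m → Fin n) → Fin m → Fin m → ℤ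
  cayleyAdj S f i j = if S (f i ∙ (f j ⁻¹)) then + 1 else + 0

  -- The vertex set H is enumerated by an arbitrary bijection
  -- f : Fin m → H (the characteristic polynomial does not depend on it).
  CayleyIntegralOn : Subset n → Set
  CayleyIntegralOn H =
    (S : Subset n) →
    (∀ g → T (S g) → T (H g)) →
    ¬ T (S e) →
    (∀ g → T (S g) → T (S (g ⁻¹))) →
    (m : ℕ) (f : Fin m → Fin n) →
    Injective _≡_ _≡_ f →
    (∀ i → T (H (f i))) →
    (∀ g → T (H g) → ∃ λ i → f i ≡ g) →
    IntegralMatrix m (cayleyAdj S f)

  CayleyIntegral : Set
  CayleyIntegral = CayleyIntegralOn (λ _ → true)

-- List G as the elements of H followed by those of G ∖ H. For S ⊆ H, an edge x ~ y
-- forces x y⁻¹ ∈ H, so no edge joins H to its complement: the adjacency matrix of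
-- Cay(G, S) is block diagonal, and its characteristic polynomial is the product of
-- the (monic) characteristic polynomials of Cay(H, S) and of the complementary block.
-- Since ℤ has no zero divisors, every integral root of this product is a root of one of
-- the factors; dividing these roots out one at a time shows that the characteristic
-- polynomial of Cay(H, S) splits into integral linear factors as well.

{-# OPTIONS --safe #-}
module Submission where

open import Defs
open import Data.Nat as ℕ using (ℕ; zero; suc; _<_; _≤_; z≤n; s≤s)
import Data.Nat.Properties as ℕP
open import Data.Integer using (ℤ; +_; -_; _+_; _*_; _-_)
import Data.Integer.Properties as ℤP
open import Data.Integer.Tactic.RingSolver using (solve-∀)
open import Data.List using (List; []; _∷_; length; lookup; filter; allFin)
import Data.List.Relation.Unary.All as All
import Data.List.Relation.Unary.Any as Any
import Data.List.Relation.Unary.Any.Properties as Any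
open import Data.List.Relation.Unary.Unique.Propositional using (Unique)
open import Data.List.Relation.Unary.AllPairs using (_∷_)
import Data.List.Relation.Unary.Unique.Propositional.Properties as Unique
open import Data.List.Membership.Propositional.Properties using (∈-lookup; ∈-filter⁺; ∈-filter⁻; ∈-allFin)
open import Data.Vec using (Vec; []; _∷_)
open import Data.Product using (Σ; ∃; _×_; _,_; proj₁; proj₂)
open import Data.Sum using (_⊎_; inj₁; inj₂; [_,_]′)
open import Data.Empty using (⊥-elim)
open import Data.Fin using (Fin; zero; suc; punchIn; toℕ; _↑ˡ_; _↑ʳ_; splitAt; join)
import Data.Fin.Properties as FP
open import Data.Bool using (Bool; true; false; if_then_else_; T)
open import Data.Unit using (tt)
open import Function using (_∘_)
open import Function.Definitions using (Injective)
open import Level using (0ℓ)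
open import Relation.Binary.Bundles using (Setoid)
open import Relation.Binary.PropositionalEquality
  using (_≡_; _≢_; _≗_; refl; sym; trans; cong; cong₂; subst; module ≡-Reasoning)
open import Relation.Nullary using (¬_; yes; no; ¬?)
open import Relation.Nullary.Decidable using (T?)
open import Relation.Unary using (Decidable)
import Relation.Binary.Reasoning.Setoid as SetoidReasoning

shift : (ℕ → ℤ) → ℕ → ℤ
shift a zero    = + 0
shift a (suc k) = a k

shift-cong : ∀ {a b : ℕ → ℤ} → a ≗ b → shift a ≗ shift b
shift-cong a≗b zero    = refl
shift-cong a≗b (suc k) = a≗b k

shift-[] : ∀ k → shift (coeff []) k ≡ + 0
shift-[] zero    = refl
shift-[] (suc k) = refl

coeff-0∷ : ∀ p → coeff (+ 0 ∷ p) ≗ shift (coeff p)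
coeff-0∷ p zero    = refl
coeff-0∷ p (suc k) = refl

coeff-+P : ∀ p q k → coeff (p +P q) k ≡ coeff p k + coeff q k
coeff-+P []      q       k       = sym (ℤP.+-identityˡ _)
coeff-+P (a ∷ p) []      k       = sym (ℤP.+-identityʳ _)
coeff-+P (a ∷ p) (b ∷ q) zero    = refl
coeff-+P (a ∷ p) (b ∷ q) (suc k) = coeff-+P p q k

coeff-scaleP : ∀ c p k → coeff (scaleP c p) k ≡ c * coeff p k
coeff-scaleP c []      k       = sym (ℤP.*-zeroʳ c)
coeff-scaleP c (a ∷ p) zero    = refl
coeff-scaleP c (a ∷ p) (suc k) = coeff-scaleP c p k

coeff-∷*P : ∀ a p q k → coeff ((a ∷ p) *P q) k ≡ a * coeff q k + shift (coeff (p *P q)) k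
coeff-∷*P a p q k = trans (coeff-+P (scaleP a q) (+ 0 ∷ p *P q) k)
  (cong₂ _+_ (coeff-scaleP a q k) (coeff-0∷ (p *P q) k))

-- Wrapping _≈P_ in a record lets Agda infer both polynomials from a proof.
infix 4 _≈_
record _≈_ (p q : Poly) : Set where
  constructor mk≈
  field coeff-≡ : p ≈P q
open _≈_

≈-refl : ∀ {p} → p ≈ p
≈-refl = mk≈ λ k → refl

≈-reflexive : ∀ {p q} → p ≡ q → p ≈ q
≈-reflexive refl = ≈-refl

≈-sym : ∀ {p q} → p ≈ q → q ≈ p
≈-sym p≈q = mk≈ λ k → sym (coeff-≡ p≈q k)

≈-trans : ∀ {p q r} → p ≈ q → q ≈ r → p ≈ r
≈-trans p≈q q≈r = mk≈ λ k → trans (coeff-≡ p≈q k) (coeff-≡ q≈r k)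

≈-setoid : Setoid 0ℓ 0ℓ
≈-setoid = record
  { Carrier       = Poly
  ; _≈_           = _≈_
  ; isEquivalence = record { refl = ≈-refl ; sym = ≈-sym ; trans = ≈-trans }
  }

module ≈-Reasoning = SetoidReasoning ≈-setoid

tailP : Poly → Poly
tailP []      = []
tailP (a ∷ p) = p

coeff-tailP : ∀ p k → coeff (tailP p) k ≡ coeff p (suc k)
coeff-tailP []      k = refl
coeff-tailP (a ∷ p) k = refl

tailP-cong : ∀ {p q} → p ≈ q → tailP p ≈ tailP q
tailP-cong {p} {q} p≈q = mk≈ λ k →
  trans (coeff-tailP p k) (trans (coeff-≡ p≈q (suc k)) (sym (coeff-tailP q k)))

∷-cong : ∀ a {p q} → p ≈ q → a ∷ p ≈ a ∷ q
∷-cong a p≈q = mk≈ λ { zero → refl ; (suc k) → coeff-≡ p≈q k }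

+P-cong : ∀ {p p′ q q′} → p ≈ p′ → q ≈ q′ → p +P q ≈ p′ +P q′
+P-cong {p} {p′} {q} {q′} p≈p′ q≈q′ = mk≈ λ k →
  trans (coeff-+P p q k)
    (trans (cong₂ _+_ (coeff-≡ p≈p′ k) (coeff-≡ q≈q′ k)) (sym (coeff-+P p′ q′ k)))

scaleP-cong : ∀ c {p q} → p ≈ q → scaleP c p ≈ scaleP c q
scaleP-cong c {p} {q} p≈q = mk≈ λ k →
  trans (coeff-scaleP c p k) (trans (cong (c *_) (coeff-≡ p≈q k)) (sym (coeff-scaleP c q k)))

*P-zeroˡ : ∀ p q → p ≈ [] → p *P q ≈ []
*P-zeroˡ []      q p≈[] = ≈-refl
*P-zeroˡ (a ∷ p) q p≈[] = mk≈ λ k → trans (coeff-∷*P a p q k)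
  (trans (cong₂ _+_ (cong (_* coeff q k) (coeff-≡ p≈[] zero))
                    (shift-cong (coeff-≡ (*P-zeroˡ p q (tailP-cong p≈[]))) k))
    (trans (ℤP.+-identityˡ _) (shift-[] k)))

*P-zeroʳ : ∀ p → p *P [] ≈ []
*P-zeroʳ []      = ≈-refl
*P-zeroʳ (a ∷ p) = mk≈ λ k → trans (coeff-∷*P a p [] k)
  (trans (cong₂ _+_ (ℤP.*-zeroʳ a) (shift-cong (coeff-≡ (*P-zeroʳ p)) k))
    (trans (ℤP.+-identityˡ _) (shift-[] k)))

*P-congʳ : ∀ p {q q′} → q ≈ q′ → p *P q ≈ p *P q′
*P-congʳ []      q≈q′ = ≈-refl
*P-congʳ (a ∷ p) {q} {q′} q≈q′ = mk≈ λ k → trans (coeff-∷*P a p q k)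
  (trans (cong₂ _+_ (cong (a *_) (coeff-≡ q≈q′ k)) (shift-cong (coeff-≡ (*P-congʳ p q≈q′)) k))
    (sym (coeff-∷*P a p q′ k)))

*P-congˡ : ∀ {p p′} q → p ≈ p′ → p *P q ≈ p′ *P q
*P-congˡ {[]}    {p′}     q p≈p′ = ≈-sym (*P-zeroˡ p′ q (≈-sym p≈p′))
*P-congˡ {a ∷ p} {[]}     q p≈p′ = *P-zeroˡ (a ∷ p) q p≈p′
*P-congˡ {a ∷ p} {b ∷ p′} q p≈p′ = mk≈ λ k → trans (coeff-∷*P a p q k)
  (trans (cong₂ _+_ (cong (_* coeff q k) (coeff-≡ p≈p′ zero))
                    (shift-cong (coeff-≡ (*P-congˡ {p} {p′} q (tailP-cong p≈p′))) k))
    (sym (coeff-∷*P b p′ q k)))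

*P-cong : ∀ {p p′ q q′} → p ≈ p′ → q ≈ q′ → p *P q ≈ p′ *P q′
*P-cong {p′ = p′} {q = q} p≈p′ q≈q′ = ≈-trans (*P-congˡ q p≈p′) (*P-congʳ p′ q≈q′)

+P-assoc : ∀ p q r → (p +P q) +P r ≈ p +P (q +P r)
+P-assoc p q r = mk≈ λ k → begin
  coeff ((p +P q) +P r) k             ≡⟨ coeff-+P (p +P q) r k ⟩
  coeff (p +P q) k + coeff r k        ≡⟨ cong (_+ coeff r k) (coeff-+P p q k) ⟩
  coeff p k + coeff q k + coeff r k   ≡⟨ ℤP.+-assoc (coeff p k) (coeff q k) (coeff r k) ⟩
  coeff p k + (coeff q k + coeff r k) ≡⟨ cong (_+_ (coeff p k)) (coeff-+P q r k) ⟨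
  coeff p k + coeff (q +P r) k        ≡⟨ coeff-+P p (q +P r) k ⟨
  coeff (p +P (q +P r)) k             ∎
  where open ≡-Reasoning

+P-identityʳ : ∀ p → p +P [] ≈ p
+P-identityʳ p = mk≈ λ k → trans (coeff-+P p [] k) (ℤP.+-identityʳ _)

*P-identityˡ : ∀ p → constP (+ 1) *P p ≈ p
*P-identityˡ p = mk≈ λ k → trans (coeff-∷*P (+ 1) [] p k) (unit k)
  where
  unit : ∀ k → + 1 * coeff p k + shift (coeff []) k ≡ coeff p k
  unit zero    = trans (ℤP.+-identityʳ _) (ℤP.*-identityˡ _)
  unit (suc k) = trans (ℤP.+-identityʳ _) (ℤP.*-identityˡ _)

*P-distribʳ : ∀ p q r → (p +P q) *P r ≈ (p *P r) +P (q *P r)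
*P-distribʳ []      q       r = ≈-refl
*P-distribʳ (a ∷ p) []      r = ≈-sym (+P-identityʳ _)
*P-distribʳ (a ∷ p) (b ∷ q) r = mk≈ λ k → begin
  coeff (((a + b) ∷ (p +P q)) *P r) k
    ≡⟨ coeff-∷*P (a + b) (p +P q) r k ⟩
  (a + b) * coeff r k + shift (coeff ((p +P q) *P r)) k
    ≡⟨ cong (_+_ ((a + b) * coeff r k)) (shift-cong (λ j →
         trans (coeff-≡ (*P-distribʳ p q r) j) (coeff-+P (p *P r) (q *P r) j)) k) ⟩
  (a + b) * coeff r k + shift (λ j → coeff (p *P r) j + coeff (q *P r) j) k
    ≡⟨ regroup k ⟩
  (a * coeff r k + shift (coeff (p *P r)) k) + (b * coeff r k + shift (coeff (q *P r)) k)
    ≡⟨ cong₂ _+_ (coeff-∷*P a p r k) (coeff-∷*P b q r k) ⟨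
  coeff ((a ∷ p) *P r) k + coeff ((b ∷ q) *P r) k
    ≡⟨ coeff-+P ((a ∷ p) *P r) ((b ∷ q) *P r) k ⟨
  coeff (((a ∷ p) *P r) +P ((b ∷ q) *P r)) k
    ∎
  where
  open ≡-Reasoning
  regroup : ∀ k → (a + b) * coeff r k + shift (λ j → coeff (p *P r) j + coeff (q *P r) j) k
                ≡ (a * coeff r k + shift (coeff (p *P r)) k) + (b * coeff r k + shift (coeff (q *P r)) k)
  regroup zero    = ring a b (coeff r zero)
    where
    ring : ∀ a b x → (a + b) * x + + 0 ≡ (a * x + + 0) + (b * x + + 0)
    ring = solve-∀
  regroup (suc k) = ring a b (coeff r (suc k)) (coeff (p *P r) k) (coeff (q *P r) k)
    where
    ring : ∀ a b x u v → (a + b) * x + (u + v) ≡ (a * x + u) + (b * x + v)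
    ring = solve-∀

*P-distribˡ : ∀ p q r → p *P (q +P r) ≈ (p *P q) +P (p *P r)
*P-distribˡ []      q r = ≈-refl
*P-distribˡ (a ∷ p) q r = mk≈ λ k → begin
  coeff ((a ∷ p) *P (q +P r)) k
    ≡⟨ coeff-∷*P a p (q +P r) k ⟩
  a * coeff (q +P r) k + shift (coeff (p *P (q +P r))) k
    ≡⟨ cong₂ _+_ (cong (a *_) (coeff-+P q r k)) (shift-cong (λ j →
         trans (coeff-≡ (*P-distribˡ p q r) j) (coeff-+P (p *P q) (p *P r) j)) k) ⟩
  a * (coeff q k + coeff r k) + shift (λ j → coeff (p *P q) j + coeff (p *P r) j) k
    ≡⟨ regroup k ⟩
  (a * coeff q k + shift (coeff (p *P q)) k) + (a * coeff r k + shift (coeff (p *P r)) k)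
    ≡⟨ cong₂ _+_ (coeff-∷*P a p q k) (coeff-∷*P a p r k) ⟨
  coeff ((a ∷ p) *P q) k + coeff ((a ∷ p) *P r) k
    ≡⟨ coeff-+P ((a ∷ p) *P q) ((a ∷ p) *P r) k ⟨
  coeff (((a ∷ p) *P q) +P ((a ∷ p) *P r)) k
    ∎
  where
  open ≡-Reasoning
  regroup : ∀ k → a * (coeff q k + coeff r k) + shift (λ j → coeff (p *P q) j + coeff (p *P r) j) k
                ≡ (a * coeff q k + shift (coeff (p *P q)) k) + (a * coeff r k + shift (coeff (p *P r)) k)
  regroup zero    = ring a (coeff q zero) (coeff r zero)
    where
    ring : ∀ a x y → a * (x + y) + + 0 ≡ (a * x + + 0) + (a * y + + 0)
    ring = solve-∀
  regroup (suc k) = ring a (coeff q (suc k)) (coeff r (suc k)) (coeff (p *P q) k) (coeff (p *P r) k)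
    where
    ring : ∀ a x y u v → a * (x + y) + (u + v) ≡ (a * x + u) + (a * y + v)
    ring = solve-∀

scaleP-*P : ∀ c p q → scaleP c p *P q ≈ scaleP c (p *P q)
scaleP-*P c []      q = ≈-refl
scaleP-*P c (a ∷ p) q = mk≈ λ k → begin
  coeff (scaleP c (a ∷ p) *P q) k
    ≡⟨ coeff-∷*P (c * a) (scaleP c p) q k ⟩
  c * a * coeff q k + shift (coeff (scaleP c p *P q)) k
    ≡⟨ cong (_+_ (c * a * coeff q k)) (shift-cong (λ j →
         trans (coeff-≡ (scaleP-*P c p q) j) (coeff-scaleP c (p *P q) j)) k) ⟩
  c * a * coeff q k + shift (λ j → c * coeff (p *P q) j) k
    ≡⟨ factorOut k ⟩
  c * (a * coeff q k + shift (coeff (p *P q)) k)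
    ≡⟨ cong (c *_) (coeff-∷*P a p q k) ⟨
  c * coeff ((a ∷ p) *P q) k
    ≡⟨ coeff-scaleP c ((a ∷ p) *P q) k ⟨
  coeff (scaleP c ((a ∷ p) *P q)) k
    ∎
  where
  open ≡-Reasoning
  factorOut : ∀ k → c * a * coeff q k + shift (λ j → c * coeff (p *P q) j) k
                  ≡ c * (a * coeff q k + shift (coeff (p *P q)) k)
  factorOut zero    = ring c a (coeff q zero)
    where
    ring : ∀ c a x → c * a * x + + 0 ≡ c * (a * x + + 0)
    ring = solve-∀
  factorOut (suc k) = ring c a (coeff q (suc k)) (coeff (p *P q) k)
    where
    ring : ∀ c a x u → c * a * x + c * u ≡ c * (a * x + u)
    ring = solve-∀

0∷-*P : ∀ p q → (+ 0 ∷ p) *P q ≈ + 0 ∷ p *P q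
0∷-*P p q = mk≈ λ k → trans (coeff-∷*P (+ 0) p q k) (shifted k)
  where
  shifted : ∀ k → + 0 * coeff q k + shift (coeff (p *P q)) k ≡ coeff (+ 0 ∷ p *P q) k
  shifted zero    = refl
  shifted (suc k) = ℤP.+-identityˡ _

*P-0∷ : ∀ p q → p *P (+ 0 ∷ q) ≈ + 0 ∷ p *P q
*P-0∷ []      q = mk≈ λ { zero → refl ; (suc k) → refl }
*P-0∷ (a ∷ p) q = mk≈ λ k → trans (coeff-∷*P a p (+ 0 ∷ q) k)
  (trans (cong (_+_ (a * coeff (+ 0 ∷ q) k)) (shift-cong (coeff-≡ (*P-0∷ p q)) k)) (shifted k))
  where
  shifted : ∀ k → a * coeff (+ 0 ∷ q) k + shift (coeff (+ 0 ∷ p *P q)) k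
                ≡ coeff (+ 0 ∷ (a ∷ p) *P q) k
  shifted zero    = trans (ℤP.+-identityʳ _) (ℤP.*-zeroʳ a)
  shifted (suc k) = sym (trans (coeff-∷*P a p q k)
                               (cong (_+_ (a * coeff q k)) (sym (coeff-0∷ (p *P q) k))))

*P-constP : ∀ p a → p *P constP a ≈ scaleP a p
*P-constP []      a = ≈-refl
*P-constP (b ∷ p) a = mk≈ λ k → trans (coeff-∷*P b p (constP a) k)
  (trans (cong (_+_ (b * coeff (constP a) k)) (shift-cong (coeff-≡ (*P-constP p a)) k)) (scaled k))
  where
  scaled : ∀ k → b * coeff (constP a) k + shift (coeff (scaleP a p)) k ≡ coeff (scaleP a (b ∷ p)) k
  scaled zero    = trans (ℤP.+-identityʳ _) (ℤP.*-comm b a)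
  scaled (suc k) = trans (cong (_+ coeff (scaleP a p) k) (ℤP.*-zeroʳ b)) (ℤP.+-identityˡ _)

∷-split : ∀ a p → a ∷ p ≈ constP a +P (+ 0 ∷ p)
∷-split a p = mk≈ λ { zero → sym (ℤP.+-identityʳ a) ; (suc k) → refl }

*P-comm : ∀ p q → p *P q ≈ q *P p
*P-comm []      q = ≈-sym (*P-zeroʳ q)
*P-comm (a ∷ p) q = begin
  scaleP a q +P (+ 0 ∷ p *P q)         ≈⟨ +P-cong (*P-constP q a) (∷-cong (+ 0) (*P-comm q p)) ⟨
  (q *P constP a) +P (+ 0 ∷ q *P p)    ≈⟨ +P-cong (≈-refl {q *P constP a}) (*P-0∷ q p) ⟨
  (q *P constP a) +P (q *P (+ 0 ∷ p))  ≈⟨ *P-distribˡ q (constP a) (+ 0 ∷ p) ⟨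
  q *P (constP a +P (+ 0 ∷ p))         ≈⟨ *P-congʳ q (∷-split a p) ⟨
  q *P (a ∷ p)                         ∎
  where open ≈-Reasoning

*P-assoc : ∀ p q r → (p *P q) *P r ≈ p *P (q *P r)
*P-assoc []      q r = ≈-refl
*P-assoc (a ∷ p) q r = begin
  (scaleP a q +P (+ 0 ∷ p *P q)) *P r         ≈⟨ *P-distribʳ (scaleP a q) (+ 0 ∷ p *P q) r ⟩
  (scaleP a q *P r) +P ((+ 0 ∷ p *P q) *P r)  ≈⟨ +P-cong (scaleP-*P a q r) (0∷-*P (p *P q) r) ⟩
  scaleP a (q *P r) +P (+ 0 ∷ (p *P q) *P r)  ≈⟨ +P-cong (≈-refl {scaleP a (q *P r)}) (∷-cong (+ 0) (*P-assoc p q r)) ⟩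
  scaleP a (q *P r) +P (+ 0 ∷ p *P (q *P r))  ∎
  where open ≈-Reasoning

record Degree≤ (d : ℕ) (p : Poly) : Set where
  constructor mkDegree≤
  field vanishes : ∀ j → d < j → coeff p j ≡ + 0
open Degree≤

record Monic (d : ℕ) (p : Poly) : Set where
  field
    degree≤ : Degree≤ d p
    leading : coeff p d ≡ + 1
open Monic

Degree≤-cong : ∀ {d p q} → p ≈ q → Degree≤ d p → Degree≤ d q
Degree≤-cong p≈q deg = mkDegree≤ λ j d<j → trans (sym (coeff-≡ p≈q j)) (vanishes deg j d<j)

Monic-cong : ∀ {d p q} → p ≈ q → Monic d p → Monic d q
Monic-cong p≈q mon = record
  { degree≤ = Degree≤-cong p≈q (degree≤ mon)
  ; leading = trans (sym (coeff-≡ p≈q _)) (leading mon)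
  }

Degree≤-mono : ∀ {d d′ p} → d ≤ d′ → Degree≤ d p → Degree≤ d′ p
Degree≤-mono d≤d′ deg = mkDegree≤ λ j d′<j → vanishes deg j (ℕP.≤-<-trans d≤d′ d′<j)

Degree≤-[] : ∀ {d} → Degree≤ d []
Degree≤-[] = mkDegree≤ λ j _ → refl

Degree≤-+P : ∀ {d p q} → Degree≤ d p → Degree≤ d q → Degree≤ d (p +P q)
Degree≤-+P {p = p} {q} degp degq = mkDegree≤ λ j d<j →
  trans (coeff-+P p q j) (cong₂ _+_ (vanishes degp j d<j) (vanishes degq j d<j))

Degree≤-scaleP : ∀ {d} c {p} → Degree≤ d p → Degree≤ d (scaleP c p)
Degree≤-scaleP c {p} deg = mkDegree≤ λ j d<j →
  trans (coeff-scaleP c p j) (trans (cong (c *_) (vanishes deg j d<j)) (ℤP.*-zeroʳ c))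

Monic-+P : ∀ {d e p q} → Monic d p → Degree≤ e q → e < d → Monic d (p +P q)
Monic-+P {d} {p = p} {q} mon degq e<d = record
  { degree≤ = Degree≤-+P (degree≤ mon) (Degree≤-mono (ℕP.<⇒≤ e<d) degq)
  ; leading = trans (coeff-+P p q d) (cong₂ _+_ (leading mon) (vanishes degq d e<d))
  }

*P-degree≤-coeff : ∀ a b p q → Degree≤ a p → Degree≤ b q →
  Degree≤ (a ℕ.+ b) (p *P q) × coeff (p *P q) (a ℕ.+ b) ≡ coeff p a * coeff q b
*P-degree≤-coeff a       b []      q degp degq = Degree≤-[] , sym (ℤP.*-zeroˡ (coeff q b))
*P-degree≤-coeff zero    b (c ∷ p) q degp degq = mkDegree≤ bounded , top
  where
  p≈[] : p ≈ []
  p≈[] = mk≈ λ j → vanishes degp (suc j) (s≤s z≤n)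
  higher≡0 : ∀ j → shift (coeff (p *P q)) j ≡ + 0
  higher≡0 j = trans (shift-cong (coeff-≡ (*P-zeroˡ p q p≈[])) j) (shift-[] j)
  bounded : ∀ j → b < j → coeff ((c ∷ p) *P q) j ≡ + 0
  bounded j b<j = trans (coeff-∷*P c p q j)
    (trans (cong₂ _+_ (cong (c *_) (vanishes degq j b<j)) (higher≡0 j))
      (trans (ℤP.+-identityʳ _) (ℤP.*-zeroʳ c)))
  top : coeff ((c ∷ p) *P q) b ≡ c * coeff q b
  top = trans (coeff-∷*P c p q b) (trans (cong (_+_ (c * coeff q b)) (higher≡0 b)) (ℤP.+-identityʳ _))
*P-degree≤-coeff (suc a) b (c ∷ p) q degp degq = mkDegree≤ bounded , top
  where
  IH : Degree≤ (a ℕ.+ b) (p *P q) × coeff (p *P q) (a ℕ.+ b) ≡ coeff p a * coeff q b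
  IH = *P-degree≤-coeff a b p q (mkDegree≤ λ j a<j → vanishes degp (suc j) (s≤s a<j)) degq
  bounded : ∀ j → suc (a ℕ.+ b) < j → coeff ((c ∷ p) *P q) j ≡ + 0
  bounded (suc j) (s≤s a+b<j) = trans (coeff-∷*P c p q (suc j))
    (trans (cong₂ _+_ (cong (c *_) (vanishes degq (suc j) (ℕP.<-trans (s≤s (ℕP.m≤n+m b a)) (s≤s a+b<j))))
                      (vanishes (proj₁ IH) j a+b<j))
      (trans (ℤP.+-identityʳ _) (ℤP.*-zeroʳ c)))
  top : coeff ((c ∷ p) *P q) (suc (a ℕ.+ b)) ≡ coeff p a * coeff q b
  top = trans (coeff-∷*P c p q (suc (a ℕ.+ b)))
    (trans (cong₂ _+_ (cong (c *_) (vanishes degq (suc (a ℕ.+ b)) (s≤s (ℕP.m≤n+m b a)))) (proj₂ IH))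
      (trans (cong (_+ coeff p a * coeff q b) (ℤP.*-zeroʳ c)) (ℤP.+-identityˡ _)))

Degree≤-*P : ∀ {a b p q} → Degree≤ a p → Degree≤ b q → Degree≤ (a ℕ.+ b) (p *P q)
Degree≤-*P {a} {b} {p} {q} degp degq = proj₁ (*P-degree≤-coeff a b p q degp degq)

Monic-*P : ∀ {a b p q} → Monic a p → Monic b q → Monic (a ℕ.+ b) (p *P q)
Monic-*P {a} {b} {p} {q} monp monq = record
  { degree≤ = proj₁ product
  ; leading = trans (proj₂ product) (cong₂ _*_ (leading monp) (leading monq))
  }
  where
  product : Degree≤ (a ℕ.+ b) (p *P q) × coeff (p *P q) (a ℕ.+ b) ≡ coeff p a * coeff q b
  product = *P-degree≤-coeff a b p q (degree≤ monp) (degree≤ monq)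

Monic-0 : ∀ {p} → Monic 0 p → p ≈ constP (+ 1)
Monic-0 mon = mk≈ λ { zero → leading mon ; (suc j) → vanishes (degree≤ mon) (suc j) (s≤s z≤n) }

coeff-beyond-length : ∀ p j → length p ≤ j → coeff p j ≡ + 0
coeff-beyond-length []      j       _           = refl
coeff-beyond-length (a ∷ p) (suc j) (s≤s len≤j) = coeff-beyond-length p j len≤j

-- Evaluation and division by a linear factor

eval : Poly → ℤ → ℤ
eval []      c = + 0
eval (a ∷ p) c = a + c * eval p c

eval-+P : ∀ p q c → eval (p +P q) c ≡ eval p c + eval q c
eval-+P []      q       c = sym (ℤP.+-identityˡ _)
eval-+P (a ∷ p) []      c = sym (ℤP.+-identityʳ _)
eval-+P (a ∷ p) (b ∷ q) c =
  trans (cong (λ v → a + b + c * v) (eval-+P p q c)) (ring a b c (eval p c) (eval q c))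
  where
  ring : ∀ a b c x y → a + b + c * (x + y) ≡ a + c * x + (b + c * y)
  ring = solve-∀

eval-scaleP : ∀ a p c → eval (scaleP a p) c ≡ a * eval p c
eval-scaleP a []      c = sym (ℤP.*-zeroʳ a)
eval-scaleP a (b ∷ p) c =
  trans (cong (λ v → a * b + c * v) (eval-scaleP a p c)) (ring a b c (eval p c))
  where
  ring : ∀ a b c x → a * b + c * (a * x) ≡ a * (b + c * x)
  ring = solve-∀

eval-*P : ∀ p q c → eval (p *P q) c ≡ eval p c * eval q c
eval-*P []      q c = refl
eval-*P (a ∷ p) q c = trans (eval-+P (scaleP a q) (+ 0 ∷ p *P q) c)
  (trans (cong₂ _+_ (eval-scaleP a q c) (cong (λ v → + 0 + c * v) (eval-*P p q c)))
    (ring a c (eval p c) (eval q c)))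
  where
  ring : ∀ a c x y → a * y + (+ 0 + c * (x * y)) ≡ (a + c * x) * y
  ring = solve-∀

eval-≈[] : ∀ p c → p ≈ [] → eval p c ≡ + 0
eval-≈[] []      c p≈[] = refl
eval-≈[] (a ∷ p) c p≈[] =
  trans (cong₂ (λ u v → u + c * v) (coeff-≡ p≈[] zero) (eval-≈[] p c (tailP-cong p≈[])))
    (cong (_+_ (+ 0)) (ℤP.*-zeroʳ c))

eval-cong : ∀ {p q} c → p ≈ q → eval p c ≡ eval q c
eval-cong {[]}    {q}     c p≈q = sym (eval-≈[] q c (≈-sym p≈q))
eval-cong {a ∷ p} {[]}    c p≈q = eval-≈[] (a ∷ p) c p≈q
eval-cong {a ∷ p} {b ∷ q} c p≈q =
  cong₂ (λ u v → u + c * v) (coeff-≡ p≈q zero) (eval-cong {p} {q} c (tailP-cong p≈q))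

constP-0 : constP (+ 0) ≈ []
constP-0 = mk≈ λ { zero → refl ; (suc k) → refl }

linear : ℤ → Poly
linear c = X +P negP (constP c)

eval-linear : ∀ c → eval (linear c) c ≡ + 0
eval-linear = ring
  where
  ring : ∀ c → (+ 0 + - (+ 1) * c) + c * (+ 1 + c * + 0) ≡ + 0
  ring = solve-∀

coeff-linear*P-zero : ∀ c s → coeff (linear c *P s) zero ≡ - c * coeff s zero
coeff-linear*P-zero c s = trans (coeff-∷*P (+ 0 + - (+ 1) * c) (+ 1 ∷ []) s zero) (ring c (coeff s zero))
  where
  ring : ∀ c x → (+ 0 + - (+ 1) * c) * x + + 0 ≡ - c * x
  ring = solve-∀

coeff-linear*P-suc : ∀ c s j → coeff (linear c *P s) (suc j) ≡ coeff s j - c * coeff s (suc j)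
coeff-linear*P-suc c s j = begin
  coeff (linear c *P s) (suc j)                  ≡⟨ coeff-∷*P (+ 0 + - (+ 1) * c) (+ 1 ∷ []) s (suc j) ⟩
  (+ 0 + - (+ 1) * c) * coeff s (suc j) + coeff (constP (+ 1) *P s) j
                                                 ≡⟨ cong (_+_ ((+ 0 + - (+ 1) * c) * coeff s (suc j))) (coeff-≡ (*P-identityˡ s) j) ⟩
  (+ 0 + - (+ 1) * c) * coeff s (suc j) + coeff s j
                                                 ≡⟨ ring c (coeff s (suc j)) (coeff s j) ⟩
  coeff s j - c * coeff s (suc j)                ∎
  where
  open ≡-Reasoning
  ring : ∀ c x y → (+ 0 + - (+ 1) * c) * x + y ≡ y - c * x
  ring = solve-∀

-- Synthetic division: the k-th coefficient of quotLinear c p is Σ_{j>k} pⱼ cʲ⁻ᵏ⁻¹.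
quotLinear : ℤ → Poly → Poly
quotLinear c []      = []
quotLinear c (a ∷ p) = eval p c ∷ quotLinear c p

linear-division : ∀ c p → p ≈ (linear c *P quotLinear c p) +P constP (eval p c)
linear-division c p = mk≈ λ k →
  trans (divides p k) (sym (coeff-+P (linear c *P quotLinear c p) (constP (eval p c)) k))
  where
  divides : ∀ p k → coeff p k ≡ coeff (linear c *P quotLinear c p) k + coeff (constP (eval p c)) k
  divides []      k             = sym (cong₂ _+_ (coeff-≡ (*P-zeroʳ (linear c)) k) (coeff-≡ constP-0 k))
  divides (a ∷ p) zero          =
    sym (trans (cong (_+ (a + c * eval p c)) (coeff-linear*P-zero c (quotLinear c (a ∷ p))))
               (ring a c (eval p c)))
    where
    ring : ∀ a c e → - c * e + (a + c * e) ≡ a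
    ring = solve-∀
  divides (a ∷ p) (suc zero)    = trans (divides p zero)
    (trans (cong (_+ eval p c) (coeff-linear*P-zero c (quotLinear c p)))
      (trans (ring c (coeff (quotLinear c p) zero) (eval p c))
        (cong (_+ + 0) (sym (coeff-linear*P-suc c (quotLinear c (a ∷ p)) zero)))))
    where
    ring : ∀ c q e → - c * q + e ≡ (e - c * q) + + 0
    ring = solve-∀
  divides (a ∷ p) (suc (suc j)) = trans (divides p (suc j))
    (cong (_+ + 0) (trans (coeff-linear*P-suc c (quotLinear c p) j)
                          (sym (coeff-linear*P-suc c (quotLinear c (a ∷ p)) (suc j)))))

factor-theorem : ∀ c p → eval p c ≡ + 0 → p ≈ linear c *P quotLinear c p
factor-theorem c p root = begin
  p                                                     ≈⟨ linear-division c p ⟩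
  (linear c *P quotLinear c p) +P constP (eval p c)     ≈⟨ +P-cong (≈-refl {linear c *P quotLinear c p})
                                                             (≈-reflexive (cong constP root)) ⟩
  (linear c *P quotLinear c p) +P constP (+ 0)          ≈⟨ +P-cong (≈-refl {linear c *P quotLinear c p}) constP-0 ⟩
  (linear c *P quotLinear c p) +P []                    ≈⟨ +P-identityʳ _ ⟩
  linear c *P quotLinear c p                            ∎
  where open ≈-Reasoning

coeff-from-linear*P : ∀ c u j → coeff u j ≡ coeff (linear c *P u) (suc j) + c * coeff u (suc j)
coeff-from-linear*P c u j =
  trans (ring (coeff u j) (coeff u (suc j)) c) (cong (_+ c * coeff u (suc j)) (sym (coeff-linear*P-suc c u j)))
  where
  ring : ∀ x y c → x ≡ (x - c * y) + c * y
  ring = solve-∀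

AgreeFrom : ℕ → Poly → Poly → Set
AgreeFrom k p q = ∀ j → k ≤ j → coeff p j ≡ coeff q j

-- Downward induction on j, starting beyond the lengths of u and v.
linear*P-reflects-AgreeFrom : ∀ c u v k →
  AgreeFrom (suc k) (linear c *P u) (linear c *P v) → AgreeFrom k u v
linear*P-reflects-AgreeFrom c u v k agree j k≤j =
  downward (length u ℕ.+ length v) j k≤j
    (ℕP.≤-trans (ℕP.m≤m+n (length u) (length v)) (ℕP.m≤n+m _ j))
    (ℕP.≤-trans (ℕP.m≤n+m (length v) (length u)) (ℕP.m≤n+m _ j))
  where
  downward : ∀ t j → k ≤ j → length u ≤ j ℕ.+ t → length v ≤ j ℕ.+ t → coeff u j ≡ coeff v j
  downward zero j k≤j lu lv = trans
    (coeff-beyond-length u j (ℕP.≤-trans lu (ℕP.≤-reflexive (ℕP.+-identityʳ j))))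
    (sym (coeff-beyond-length v j (ℕP.≤-trans lv (ℕP.≤-reflexive (ℕP.+-identityʳ j)))))
  downward (suc t) j k≤j lu lv = begin
    coeff u j                                                ≡⟨ coeff-from-linear*P c u j ⟩
    coeff (linear c *P u) (suc j) + c * coeff u (suc j)      ≡⟨ cong₂ (λ x y → x + c * y)
                                                                  (agree (suc j) (s≤s k≤j)) next ⟩
    coeff (linear c *P v) (suc j) + c * coeff v (suc j)      ≡⟨ coeff-from-linear*P c v j ⟨
    coeff v j                                                ∎
    where
    open ≡-Reasoning
    next : coeff u (suc j) ≡ coeff v (suc j)
    next = downward t (suc j) (ℕP.m≤n⇒m≤1+n k≤j)
      (ℕP.≤-trans lu (ℕP.≤-reflexive (ℕP.+-suc j t)))
      (ℕP.≤-trans lv (ℕP.≤-reflexive (ℕP.+-suc j t)))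

linear*P-cancel : ∀ c {u v} → linear c *P u ≈ linear c *P v → u ≈ v
linear*P-cancel c {u} {v} Lu≈Lv =
  mk≈ λ j → linear*P-reflects-AgreeFrom c u v 0 (λ j _ → coeff-≡ Lu≈Lv j) j z≤n

Monic-quotient : ∀ {c d p s} → p ≈ linear c *P s → Monic (suc d) p → Monic d s
Monic-quotient {c} {d} {p} {s} p≈Ls mon = record { degree≤ = mkDegree≤ bounded ; leading = top }
  where
  beyond : AgreeFrom (suc (suc d)) (linear c *P s) (linear c *P [])
  beyond j d+1<j = trans (sym (coeff-≡ p≈Ls j))
    (trans (vanishes (degree≤ mon) j d+1<j) (sym (coeff-≡ (*P-zeroʳ (linear c)) j)))
  bounded : ∀ j → d < j → coeff s j ≡ + 0
  bounded = linear*P-reflects-AgreeFrom c s [] (suc d) beyond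
  top : coeff s d ≡ + 1
  top = begin
    coeff s d                                             ≡⟨ coeff-from-linear*P c s d ⟩
    coeff (linear c *P s) (suc d) + c * coeff s (suc d)   ≡⟨ cong₂ (λ x y → x + c * y)
                                                               (trans (sym (coeff-≡ p≈Ls (suc d))) (leading mon))
                                                               (bounded (suc d) ℕP.≤-refl) ⟩
    + 1 + c * + 0                                         ≡⟨ cong (_+_ (+ 1)) (ℤP.*-zeroʳ c) ⟩
    + 1                                                   ∎
    where open ≡-Reasoning

-- Splitting into integral linear factors

Splits : ℕ → Poly → Set
Splits d p = Σ (Vec ℤ d) λ ls → p ≈ prodLinear ls

Monic-0-rootless : ∀ {p} c → Monic 0 p → eval p c ≢ + 0
Monic-0-rootless {p} c mon root = +1≢+0 (begin
  + 1                      ≡⟨ cong (_+_ (+ 1)) (ℤP.*-zeroʳ c) ⟨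
  eval (constP (+ 1)) c    ≡⟨ eval-cong {p} c (Monic-0 mon) ⟨
  eval p c                 ≡⟨ root ⟩
  + 0                      ∎)
  where
  open ≡-Reasoning
  +1≢+0 : + 1 ≢ + 0
  +1≢+0 ()

Monic-root : ∀ c {d p} → Monic (suc d) p → eval p c ≡ + 0 →
  Σ Poly λ s → Monic d s × p ≈ linear c *P s
Monic-root c {d} {p} mon root = quotLinear c p , Monic-quotient {c} p≈Ls mon , p≈Ls
  where
  p≈Ls : p ≈ linear c *P quotLinear c p
  p≈Ls = factor-theorem c p root

root-of-factor : ∀ {N p q} l (ls : Vec ℤ N) → p *P q ≈ prodLinear (l ∷ ls) →
  eval p l ≡ + 0 ⊎ eval q l ≡ + 0
root-of-factor {p = p} {q} l ls pq≈ = ℤP.i*j≡0⇒i≡0∨j≡0 (eval p l) (begin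
  eval p l * eval q l                                 ≡⟨ eval-*P p q l ⟨
  eval (p *P q) l                                     ≡⟨ eval-cong l pq≈ ⟩
  eval (linear l *P prodLinear ls) l                  ≡⟨ eval-*P (linear l) (prodLinear ls) l ⟩
  eval (linear l) l * eval (prodLinear ls) l          ≡⟨ cong (_* eval (prodLinear ls) l) (eval-linear l) ⟩
  + 0 * eval (prodLinear ls) l                        ≡⟨ ℤP.*-zeroˡ (eval (prodLinear ls) l) ⟩
  + 0                                                 ∎)
  where open ≡-Reasoning

Monic-factor-splits : ∀ {N d e p q} (ls : Vec ℤ N) → Monic d p → Monic e q →
  p *P q ≈ prodLinear ls → Splits d p
Monic-factor-splits {d = zero} ls monp monq pq≈ = [] , Monic-0 monp
Monic-factor-splits {d = suc d} {e} [] monp monq pq≈1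
  with trans (sym (leading (Monic-*P monp monq))) (coeff-≡ pq≈1 (suc (d ℕ.+ e)))
... | ()
Monic-factor-splits {d = suc d} {e} {p} {q} (l ∷ ls) monp monq pq≈ with root-of-factor {p = p} {q} l ls pq≈
... | inj₁ p-root =
  let s , mons , p≈Ls = Monic-root l monp p-root
      ls′ , s≈ = Monic-factor-splits ls mons monq (linear*P-cancel l (begin
        linear l *P (s *P q)     ≈⟨ *P-assoc (linear l) s q ⟨
        (linear l *P s) *P q     ≈⟨ *P-congˡ q p≈Ls ⟨
        p *P q                   ≈⟨ pq≈ ⟩
        linear l *P prodLinear ls ∎))
  in l ∷ ls′ , ≈-trans p≈Ls (*P-congʳ (linear l) s≈)
  where open ≈-Reasoning
... | inj₂ q-root with e
...   | zero   = ⊥-elim (Monic-0-rootless l monq q-root)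
...   | suc e′ =
  let t , mont , q≈Lt = Monic-root l monq q-root
  in Monic-factor-splits ls monp mont (linear*P-cancel l (begin
       linear l *P (p *P t)      ≈⟨ *P-assoc (linear l) p t ⟨
       (linear l *P p) *P t      ≈⟨ *P-congˡ t (*P-comm (linear l) p) ⟩
       (p *P linear l) *P t      ≈⟨ *P-assoc p (linear l) t ⟩
       p *P (linear l *P t)      ≈⟨ *P-congʳ p q≈Lt ⟨
       p *P q                    ≈⟨ pq≈ ⟩
       linear l *P prodLinear ls ∎))
  where open ≈-Reasoning

-- Determinants

Matrix : Set → ℕ → Set
Matrix A n = Fin n → Fin n → A

upperLeft : ∀ {A} a b → Matrix A (a ℕ.+ b) → Matrix A a
upperLeft a b M i j = M (i ↑ˡ b) (j ↑ˡ b)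

lowerRight : ∀ {A} a b → Matrix A (a ℕ.+ b) → Matrix A b
lowerRight a b M i j = M (a ↑ʳ i) (a ↑ʳ j)

minor : ∀ {A n} → Matrix A (suc n) → Fin (suc n) → Matrix A n
minor M j i k = M (suc i) (punchIn j k)

expansionTerm : ∀ {n} → Matrix Poly (suc n) → Fin (suc n) → Poly
expansionTerm {n} M j = signP (toℕ j) (M zero j *P det n (minor M j))

sumFin-cong : ∀ {n} {f g : Fin n → Poly} → (∀ j → f j ≈ g j) → sumFin f ≈ sumFin g
sumFin-cong {zero}  f≈g = ≈-refl
sumFin-cong {suc n} f≈g = +P-cong (f≈g zero) (sumFin-cong (λ j → f≈g (suc j)))

sumFin-≈[] : ∀ {n} {f : Fin n → Poly} → (∀ j → f j ≈ []) → sumFin f ≈ []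
sumFin-≈[] {zero}  f≈[] = ≈-refl
sumFin-≈[] {suc n} f≈[] = +P-cong (f≈[] zero) (sumFin-≈[] (λ j → f≈[] (suc j)))

sumFin-+ : ∀ a b (f : Fin (a ℕ.+ b) → Poly) →
  sumFin f ≈ sumFin (λ i → f (i ↑ˡ b)) +P sumFin (λ j → f (a ↑ʳ j))
sumFin-+ zero    b f = ≈-refl
sumFin-+ (suc a) b f = ≈-trans (+P-cong (≈-refl {f zero}) (sumFin-+ a b (λ i → f (suc i))))
  (≈-sym (+P-assoc (f zero) (sumFin (λ i → f (suc (i ↑ˡ b)))) (sumFin (λ j → f (suc (a ↑ʳ j))))))

sumFin-*P : ∀ {n} (f : Fin n → Poly) q → sumFin f *P q ≈ sumFin (λ j → f j *P q)
sumFin-*P {zero}  f q = ≈-refl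
sumFin-*P {suc n} f q = ≈-trans (*P-distribʳ (f zero) (sumFin (λ j → f (suc j))) q)
  (+P-cong (≈-refl {f zero *P q}) (sumFin-*P (λ j → f (suc j)) q))

Degree≤-sumFin : ∀ {n d} {f : Fin n → Poly} → (∀ j → Degree≤ d (f j)) → Degree≤ d (sumFin f)
Degree≤-sumFin {zero}  deg = Degree≤-[]
Degree≤-sumFin {suc n} deg = Degree≤-+P (deg zero) (Degree≤-sumFin (λ j → deg (suc j)))

signP-cong : ∀ k {p q} → p ≈ q → signP k p ≈ signP k q
signP-cong zero          p≈q = p≈q
signP-cong (suc zero)    p≈q = scaleP-cong _ p≈q
signP-cong (suc (suc k)) p≈q = signP-cong k p≈q

signP-*P : ∀ k p q → signP k p *P q ≈ signP k (p *P q)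
signP-*P zero          p q = ≈-refl
signP-*P (suc zero)    p q = scaleP-*P _ p q
signP-*P (suc (suc k)) p q = signP-*P k p q

signP-≈[] : ∀ k {p} → p ≈ [] → signP k p ≈ []
signP-≈[] zero          p≈[] = p≈[]
signP-≈[] (suc zero)    p≈[] = scaleP-cong _ p≈[]
signP-≈[] (suc (suc k)) p≈[] = signP-≈[] k p≈[]

Degree≤-signP : ∀ k {d p} → Degree≤ d p → Degree≤ d (signP k p)
Degree≤-signP zero          deg = deg
Degree≤-signP (suc zero)    deg = Degree≤-scaleP _ deg
Degree≤-signP (suc (suc k)) deg = Degree≤-signP k deg

Monic-constP1 : Monic 0 (constP (+ 1))
Monic-constP1 = record { degree≤ = mkDegree≤ λ { (suc j) _ → refl } ; leading = refl }

det-cong : ∀ n {M M′ : Matrix Poly n} → (∀ i j → M i j ≈ M′ i j) → det n M ≈ det n M′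
det-cong zero    M≈M′ = ≈-refl
det-cong (suc n) M≈M′ = sumFin-cong λ j → signP-cong (toℕ j)
  (*P-cong (M≈M′ zero j) (det-cong n λ i k → M≈M′ (suc i) (punchIn j k)))

Degree≤-det : ∀ n (M : Matrix Poly n) → (∀ i j → Degree≤ 1 (M i j)) → Degree≤ n (det n M)
Degree≤-det zero    M deg = degree≤ Monic-constP1
Degree≤-det (suc n) M deg = Degree≤-sumFin λ j → Degree≤-signP (toℕ j)
  (Degree≤-*P (deg zero j) (Degree≤-det n (minor M j) λ i k → deg (suc i) (punchIn j k)))

-- Only the diagonal term of the expansion along the first row reaches degree n.
Monic-det : ∀ n (M : Matrix Poly n) → (∀ i → Monic 1 (M i i)) → (∀ i j → Degree≤ 1 (M i j)) →
  (∀ i j → i ≢ j → Degree≤ 0 (M i j)) → Monic n (det n M)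
Monic-det zero    M mon deg offdeg = Monic-constP1
Monic-det (suc n) M mon deg offdeg = Monic-+P {e = n} diagonalTerm otherTerms ℕP.≤-refl
  where
  diagonalTerm : Monic (suc n) (M zero zero *P det n (minor M zero))
  diagonalTerm = Monic-*P (mon zero) (Monic-det n (minor M zero) (λ i → mon (suc i))
    (λ i k → deg (suc i) (suc k)) (λ i k i≢k → offdeg (suc i) (suc k) (λ eq → i≢k (FP.suc-injective eq))))
  otherTerms : Degree≤ n (sumFin (λ j → expansionTerm M (suc j)))
  otherTerms = Degree≤-sumFin λ j → Degree≤-signP (toℕ (suc j))
    (Degree≤-*P (offdeg zero (suc j) (λ ())) (Degree≤-det n (minor M (suc j)) λ i k → deg (suc i) (punchIn (suc j) k)))

punchIn-↑ˡ : ∀ {a} b (j : Fin (suc a)) (k : Fin a) → punchIn (j ↑ˡ b) (k ↑ˡ b) ≡ punchIn j k ↑ˡ b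
punchIn-↑ˡ b zero    k       = refl
punchIn-↑ˡ b (suc j) zero    = refl
punchIn-↑ˡ b (suc j) (suc k) = cong suc (punchIn-↑ˡ b j k)

punchIn-↑ʳ : ∀ a {b} (j : Fin (suc a)) (k : Fin b) → punchIn (j ↑ˡ b) (a ↑ʳ k) ≡ suc a ↑ʳ k
punchIn-↑ʳ a       zero    k = refl
punchIn-↑ʳ (suc a) (suc j) k = cong suc (punchIn-↑ʳ a j k)

det-blockDiag : ∀ a b (M : Matrix Poly (a ℕ.+ b)) →
  (∀ i j → M (i ↑ˡ b) (a ↑ʳ j) ≈ []) → (∀ i j → M (a ↑ʳ i) (j ↑ˡ b) ≈ []) →
  det (a ℕ.+ b) M ≈ det a (upperLeft a b M) *P det b (lowerRight a b M)
det-blockDiag zero    b M upper≈[] lower≈[] = ≈-sym (*P-identityˡ (det b M))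
det-blockDiag (suc a) b M upper≈[] lower≈[] = begin
  sumFin (expansionTerm M)
    ≈⟨ sumFin-+ (suc a) b (expansionTerm M) ⟩
  sumFin (λ j → expansionTerm M (j ↑ˡ b)) +P sumFin (λ k → expansionTerm M (suc a ↑ʳ k))
    ≈⟨ +P-cong (sumFin-cong splitTerm) (sumFin-≈[] λ k →
         signP-≈[] (toℕ (suc a ↑ʳ k)) (*P-zeroˡ _ _ (upper≈[] zero k))) ⟩
  sumFin (λ j → expansionTerm (upperLeft (suc a) b M) j *P D) +P []
    ≈⟨ +P-identityʳ _ ⟩
  sumFin (λ j → expansionTerm (upperLeft (suc a) b M) j *P D)
    ≈⟨ sumFin-*P (expansionTerm (upperLeft (suc a) b M)) D ⟨
  sumFin (expansionTerm (upperLeft (suc a) b M)) *P D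
    ∎
  where
  open ≈-Reasoning
  D : Poly
  D = det b (lowerRight (suc a) b M)
  minor-blockDiag : ∀ j → det (a ℕ.+ b) (minor M (j ↑ˡ b)) ≈ det a (minor (upperLeft (suc a) b M) j) *P D
  minor-blockDiag j = ≈-trans
    (det-blockDiag a b (minor M (j ↑ˡ b))
      (λ i k → ≈-trans (≈-reflexive (cong (M (suc i ↑ˡ b)) (punchIn-↑ʳ a j k))) (upper≈[] (suc i) k))
      (λ i k → ≈-trans (≈-reflexive (cong (M (suc a ↑ʳ i)) (punchIn-↑ˡ b j k))) (lower≈[] i (punchIn j k))))
    (*P-cong (det-cong a λ i k → ≈-reflexive (cong (M (suc i ↑ˡ b)) (punchIn-↑ˡ b j k)))
             (det-cong b λ i k → ≈-reflexive (cong (M (suc a ↑ʳ i)) (punchIn-↑ʳ a j k))))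
  splitTerm : ∀ j → expansionTerm M (j ↑ˡ b) ≈ expansionTerm (upperLeft (suc a) b M) j *P D
  splitTerm j = begin
    signP (toℕ (j ↑ˡ b)) (M zero (j ↑ˡ b) *P det (a ℕ.+ b) (minor M (j ↑ˡ b)))
      ≡⟨ cong (λ t → signP t (M zero (j ↑ˡ b) *P det (a ℕ.+ b) (minor M (j ↑ˡ b)))) (FP.toℕ-↑ˡ j b) ⟩
    signP (toℕ j) (M zero (j ↑ˡ b) *P det (a ℕ.+ b) (minor M (j ↑ˡ b)))
      ≈⟨ signP-cong (toℕ j) (*P-congʳ (M zero (j ↑ˡ b)) (minor-blockDiag j)) ⟩
    signP (toℕ j) (M zero (j ↑ˡ b) *P (det a (minor (upperLeft (suc a) b M) j) *P D))
      ≈⟨ signP-cong (toℕ j) (*P-assoc (M zero (j ↑ˡ b)) _ D) ⟨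
    signP (toℕ j) ((M zero (j ↑ˡ b) *P det a (minor (upperLeft (suc a) b M) j)) *P D)
      ≈⟨ signP-*P (toℕ j) _ D ⟨
    expansionTerm (upperLeft (suc a) b M) j *P D
      ∎

diagonal? : ∀ {n} → Fin n → Fin n → Bool
diagonal? zero    zero    = true
diagonal? zero    (suc _) = false
diagonal? (suc _) zero    = false
diagonal? (suc i) (suc j) = diagonal? i j

diagonal?-refl : ∀ {n} (i : Fin n) → diagonal? i i ≡ true
diagonal?-refl zero    = refl
diagonal?-refl (suc i) = diagonal?-refl i

diagonal?-≢ : ∀ {n} (i j : Fin n) → i ≢ j → diagonal? i j ≡ false
diagonal?-≢ zero    zero    i≢j = ⊥-elim (i≢j refl)
diagonal?-≢ zero    (suc j) i≢j = refl
diagonal?-≢ (suc i) zero    i≢j = refl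
diagonal?-≢ (suc i) (suc j) i≢j = diagonal?-≢ i j (λ eq → i≢j (cong suc eq))

diagonal?-↑ˡ : ∀ {a} b (i j : Fin a) → diagonal? (i ↑ˡ b) (j ↑ˡ b) ≡ diagonal? i j
diagonal?-↑ˡ b zero    zero    = refl
diagonal?-↑ˡ b zero    (suc j) = refl
diagonal?-↑ˡ b (suc i) zero    = refl
diagonal?-↑ˡ b (suc i) (suc j) = diagonal?-↑ˡ b i j

diagonal?-↑ʳ : ∀ a {b} (i j : Fin b) → diagonal? (a ↑ʳ i) (a ↑ʳ j) ≡ diagonal? i j
diagonal?-↑ʳ zero    i j = refl
diagonal?-↑ʳ (suc a) i j = diagonal?-↑ʳ a i j

diagonal?-↑ˡ↑ʳ : ∀ {a b} (i : Fin a) (j : Fin b) → diagonal? (i ↑ˡ b) (a ↑ʳ j) ≡ false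
diagonal?-↑ˡ↑ʳ zero    j = refl
diagonal?-↑ˡ↑ʳ (suc i) j = diagonal?-↑ˡ↑ʳ i j

diagonal?-↑ʳ↑ˡ : ∀ {a b} (i : Fin b) (j : Fin a) → diagonal? (a ↑ʳ i) (j ↑ˡ b) ≡ false
diagonal?-↑ʳ↑ˡ {suc a} i zero    = refl
diagonal?-↑ʳ↑ˡ {suc a} i (suc j) = diagonal?-↑ʳ↑ˡ i j

charEntry : Bool → ℤ → Poly
charEntry b a = (if b then X else []) +P negP (constP a)

charMatrix : ∀ {n} → Matrix ℤ n → Matrix Poly n
charMatrix A i j = charEntry (diagonal? i j) (A i j)

Monic-charEntry-diagonal : ∀ a → Monic 1 (charEntry true a)
Monic-charEntry-diagonal a = record
  { degree≤ = mkDegree≤ λ { (suc zero) (s≤s ()) ; (suc (suc j)) _ → refl }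
  ; leading = refl
  }

Degree≤-charEntry : ∀ b a → Degree≤ 1 (charEntry b a)
Degree≤-charEntry true  a = degree≤ (Monic-charEntry-diagonal a)
Degree≤-charEntry false a = Degree≤-mono z≤n (mkDegree≤ λ { (suc j) _ → refl })

charEntry-off-diagonal-0 : charEntry false (+ 0) ≈ []
charEntry-off-diagonal-0 = mk≈ λ { zero → refl ; (suc j) → refl }

-- The matrix whose determinant charPoly is, obtained by unification: its diagonal test is local to Defs.
charPolyMatrix : ∀ n (A : Matrix ℤ n) → Σ (Matrix Poly n) λ M → charPoly n A ≡ det n M
charPolyMatrix n A = _ , refl

charPolyMatrix-entries : ∀ n A (i j : Fin n) → proj₁ (charPolyMatrix n A) i j ≡ charMatrix A i j
charPolyMatrix-entries (suc n) A zero    zero    = refl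
charPolyMatrix-entries (suc n) A zero    (suc j) = refl
charPolyMatrix-entries (suc n) A (suc i) zero    = refl
charPolyMatrix-entries (suc n) A (suc i) (suc j) = charPolyMatrix-entries n (λ k l → A (suc k) (suc l)) i j

charPoly≈det-charMatrix : ∀ n A → charPoly n A ≈ det n (charMatrix A)
charPoly≈det-charMatrix n A = det-cong n λ i j → ≈-reflexive (charPolyMatrix-entries n A i j)

Monic-charPoly : ∀ n A → Monic n (charPoly n A)
Monic-charPoly n A = Monic-cong (≈-sym (charPoly≈det-charMatrix n A))
  (Monic-det n (charMatrix A) monic (λ i j → Degree≤-charEntry (diagonal? i j) (A i j)) offDiagonal)
  where
  monic : ∀ i → Monic 1 (charMatrix A i i)
  monic i rewrite diagonal?-refl i = Monic-charEntry-diagonal (A i i)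
  offDiagonal : ∀ i j → i ≢ j → Degree≤ 0 (charMatrix A i j)
  offDiagonal i j i≢j rewrite diagonal?-≢ i j i≢j = mkDegree≤ λ { (suc k) _ → refl }

charPoly-blockDiag : ∀ a b (A : Matrix ℤ (a ℕ.+ b)) →
  (∀ i j → A (i ↑ˡ b) (a ↑ʳ j) ≡ + 0) → (∀ i j → A (a ↑ʳ i) (j ↑ˡ b) ≡ + 0) →
  charPoly (a ℕ.+ b) A ≈ charPoly a (upperLeft a b A) *P charPoly b (lowerRight a b A)
charPoly-blockDiag a b A upper≡0 lower≡0 = begin
  charPoly (a ℕ.+ b) A
    ≈⟨ charPoly≈det-charMatrix (a ℕ.+ b) A ⟩
  det (a ℕ.+ b) (charMatrix A)
    ≈⟨ det-blockDiag a b (charMatrix A) upper≈[] lower≈[] ⟩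
  det a (upperLeft a b (charMatrix A)) *P det b (lowerRight a b (charMatrix A))
    ≈⟨ *P-cong (det-cong a λ i j → ≈-reflexive (cong (λ d → charEntry d (A (i ↑ˡ b) (j ↑ˡ b))) (diagonal?-↑ˡ b i j)))
               (det-cong b λ i j → ≈-reflexive (cong (λ d → charEntry d (A (a ↑ʳ i) (a ↑ʳ j))) (diagonal?-↑ʳ a i j))) ⟩
  det a (charMatrix (upperLeft a b A)) *P det b (charMatrix (lowerRight a b A))
    ≈⟨ *P-cong (charPoly≈det-charMatrix a (upperLeft a b A)) (charPoly≈det-charMatrix b (lowerRight a b A)) ⟨
  charPoly a (upperLeft a b A) *P charPoly b (lowerRight a b A)
    ∎
  where
  open ≈-Reasoning
  upper≈[] : ∀ i j → charMatrix A (i ↑ˡ b) (a ↑ʳ j) ≈ []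
  upper≈[] i j rewrite diagonal?-↑ˡ↑ʳ {a} {b} i j | upper≡0 i j = charEntry-off-diagonal-0
  lower≈[] : ∀ i j → charMatrix A (a ↑ʳ i) (j ↑ˡ b) ≈ []
  lower≈[] i j rewrite diagonal?-↑ʳ↑ˡ {a} {b} i j | lower≡0 i j = charEntry-off-diagonal-0

IntegralMatrix-cong : ∀ {n} {A B : Matrix ℤ n} → (∀ i j → A i j ≡ B i j) → IntegralMatrix n A → IntegralMatrix n B
IntegralMatrix-cong {n} {A} {B} A≡B (ls , χA≈) = ls , coeff-≡ (begin
  charPoly n B             ≈⟨ charPoly≈det-charMatrix n B ⟩
  det n (charMatrix B)     ≈⟨ det-cong n (λ i j → ≈-reflexive (cong (charEntry (diagonal? i j)) (A≡B i j))) ⟨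
  det n (charMatrix A)     ≈⟨ charPoly≈det-charMatrix n A ⟨
  charPoly n A             ≈⟨ mk≈ χA≈ ⟩
  prodLinear ls            ∎)
  where open ≈-Reasoning

IntegralMatrix-upperLeft : ∀ a b (A : Matrix ℤ (a ℕ.+ b)) →
  (∀ i j → A (i ↑ˡ b) (a ↑ʳ j) ≡ + 0) → (∀ i j → A (a ↑ʳ i) (j ↑ˡ b) ≡ + 0) →
  IntegralMatrix (a ℕ.+ b) A → IntegralMatrix a (upperLeft a b A)
IntegralMatrix-upperLeft a b A upper≡0 lower≡0 (ls , χA≈) =
  let ls′ , χ≈ = Monic-factor-splits ls (Monic-charPoly a (upperLeft a b A)) (Monic-charPoly b (lowerRight a b A))
                   (≈-trans (≈-sym (charPoly-blockDiag a b A upper≡0 lower≡0)) (mk≈ χA≈))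
  in ls′ , coeff-≡ χ≈

-- Enumerations of subsets of Fin n

record Enumeration {n} (P : Fin n → Set) : Set where
  field
    size      : ℕ
    elem      : Fin size → Fin n
    injective : Injective _≡_ _≡_ elem
    sound     : ∀ i → P (elem i)
    complete  : ∀ x → P x → ∃ λ i → elem i ≡ x

lookup-injective : ∀ {A : Set} {xs : List A} → Unique xs → Injective _≡_ _≡_ (lookup xs)
lookup-injective {xs = x ∷ xs} (x∉xs ∷ uniq) {zero}  {zero}  eq = refl
lookup-injective {xs = x ∷ xs} (x∉xs ∷ uniq) {zero}  {suc j} eq = ⊥-elim (All.lookup x∉xs (∈-lookup j) eq)
lookup-injective {xs = x ∷ xs} (x∉xs ∷ uniq) {suc i} {zero}  eq = ⊥-elim (All.lookup x∉xs (∈-lookup i) (sym eq))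
lookup-injective {xs = x ∷ xs} (x∉xs ∷ uniq) {suc i} {suc j} eq = cong suc (lookup-injective uniq eq)

enumerate : ∀ {n} {P : Fin n → Set} → Decidable P → Enumeration P
enumerate {n} P? = record
  { size      = length members
  ; elem      = lookup members
  ; injective = lookup-injective (Unique.filter⁺ P? (Unique.allFin⁺ n))
  ; sound     = λ i → proj₂ (∈-filter⁻ P? {xs = allFin n} (∈-lookup i))
  ; complete  = λ x px → let x∈ = ∈-filter⁺ P? (∈-allFin x) px
                         in Any.index x∈ , sym (Any.lookup-index x∈)
  }
  where
  members : List (Fin n)
  members = filter P? (allFin n)

[,]-injective : ∀ {A B C : Set} {f : A → C} {g : B → C} → Injective _≡_ _≡_ f → Injective _≡_ _≡_ g →
  (∀ a b → f a ≢ g b) → Injective _≡_ _≡_ [ f , g ]′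
[,]-injective f-inj g-inj disjoint {inj₁ a} {inj₁ a′} eq = cong inj₁ (f-inj eq)
[,]-injective f-inj g-inj disjoint {inj₁ a} {inj₂ b}  eq = ⊥-elim (disjoint a b eq)
[,]-injective f-inj g-inj disjoint {inj₂ b} {inj₁ a}  eq = ⊥-elim (disjoint a b (sym eq))
[,]-injective f-inj g-inj disjoint {inj₂ b} {inj₂ b′} eq = cong inj₂ (g-inj eq)

module _ {n} {P : Fin n → Set} (P? : Decidable P) (E : Enumeration P) (Eᶜ : Enumeration (¬_ ∘ P)) where
  private
    module E  = Enumeration E
    module Eᶜ = Enumeration Eᶜ

  concatElem : Fin (E.size ℕ.+ Eᶜ.size) → Fin n
  concatElem k = [ E.elem , Eᶜ.elem ]′ (splitAt E.size k)

  concatElem-↑ˡ : ∀ i → concatElem (i ↑ˡ Eᶜ.size) ≡ E.elem i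
  concatElem-↑ˡ i = cong [ E.elem , Eᶜ.elem ]′ (FP.splitAt-↑ˡ E.size i Eᶜ.size)

  concatElem-↑ʳ : ∀ j → concatElem (E.size ↑ʳ j) ≡ Eᶜ.elem j
  concatElem-↑ʳ j = cong [ E.elem , Eᶜ.elem ]′ (FP.splitAt-↑ʳ E.size Eᶜ.size j)

  concatElem-injective : Injective _≡_ _≡_ concatElem
  concatElem-injective {k} {k′} eq = begin
    k                                         ≡⟨ FP.join-splitAt E.size Eᶜ.size k ⟨
    join E.size Eᶜ.size (splitAt E.size k)    ≡⟨ cong (join E.size Eᶜ.size) (split-injective {splitAt E.size k} {splitAt E.size k′} eq) ⟩
    join E.size Eᶜ.size (splitAt E.size k′)   ≡⟨ FP.join-splitAt E.size Eᶜ.size k′ ⟩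
    k′                                        ∎
    where
    open ≡-Reasoning
    split-injective : Injective _≡_ _≡_ [ E.elem , Eᶜ.elem ]′
    split-injective = [,]-injective E.injective Eᶜ.injective
      (λ i j eq → Eᶜ.sound j (subst P eq (E.sound i)))

  concatElem-surjective : ∀ x → ∃ λ k → concatElem k ≡ x
  concatElem-surjective x with P? x
  ... | yes px = let i , eq = E.complete x px in i ↑ˡ Eᶜ.size , trans (concatElem-↑ˡ i) eq
  ... | no ¬px = let j , eq = Eᶜ.complete x ¬px in E.size ↑ʳ j , trans (concatElem-↑ʳ j) eq

-- Cayley graphs of subgroups

module _ {n} (G : FinGroup n) where
  open FinGroup G

  ⁻¹-involutive : ∀ x → (x ⁻¹) ⁻¹ ≡ x
  ⁻¹-involutive x = begin
    (x ⁻¹) ⁻¹                 ≡⟨ identityʳ _ ⟨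
    (x ⁻¹) ⁻¹ ∙ e             ≡⟨ cong ((x ⁻¹) ⁻¹ ∙_) (inverseˡ x) ⟨
    (x ⁻¹) ⁻¹ ∙ (x ⁻¹ ∙ x)    ≡⟨ assoc _ _ _ ⟨
    ((x ⁻¹) ⁻¹ ∙ x ⁻¹) ∙ x    ≡⟨ cong (_∙ x) (inverseˡ (x ⁻¹)) ⟩
    e ∙ x                     ≡⟨ identityˡ x ⟩
    x                         ∎
    where open ≡-Reasoning

  module _ {H : Subset n} (H≤G : IsSubgroup G H) where
    private
      ∙-closed : ∀ x y → T (H x) → T (H y) → T (H (x ∙ y))
      ∙-closed = proj₁ (proj₂ H≤G)
      ⁻¹-closed : ∀ x → T (H x) → T (H (x ⁻¹))
      ⁻¹-closed = proj₂ (proj₂ H≤G)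

    ∈-from-left-quotient : ∀ {x y} → T (H x) → T (H (x ∙ y ⁻¹)) → T (H y)
    ∈-from-left-quotient {x} {y} x∈H xy⁻¹∈H = subst (T ∘ H) (⁻¹-involutive y)
      (⁻¹-closed (y ⁻¹) (subst (T ∘ H) x⁻¹xy⁻¹≡y⁻¹ (∙-closed (x ⁻¹) (x ∙ y ⁻¹) (⁻¹-closed x x∈H) xy⁻¹∈H)))
      where
      x⁻¹xy⁻¹≡y⁻¹ : x ⁻¹ ∙ (x ∙ y ⁻¹) ≡ y ⁻¹
      x⁻¹xy⁻¹≡y⁻¹ = trans (sym (assoc _ _ _)) (trans (cong (_∙ y ⁻¹) (inverseˡ x)) (identityˡ _))

    ∈-from-right-quotient : ∀ {x y} → T (H x) → T (H (y ∙ x ⁻¹)) → T (H y)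
    ∈-from-right-quotient {x} {y} x∈H yx⁻¹∈H = subst (T ∘ H) yx⁻¹x≡y (∙-closed (y ∙ x ⁻¹) x yx⁻¹∈H x∈H)
      where
      yx⁻¹x≡y : (y ∙ x ⁻¹) ∙ x ≡ y
      yx⁻¹x≡y = trans (assoc _ _ _) (trans (cong (y ∙_) (inverseˡ x)) (identityʳ y))

    cayleyAdj-leaving : ∀ {S : Subset n} → (∀ g → T (S g) → T (H g)) →
      ∀ {m} (f : Fin m → Fin n) i j → T (H (f i)) → ¬ T (H (f j)) →
      cayleyAdj G S f i j ≡ + 0 × cayleyAdj G S f j i ≡ + 0
    cayleyAdj-leaving {S} S⊆H f i j fi∈H fj∉H =
      not-adjacent (λ s → fj∉H (∈-from-left-quotient fi∈H (S⊆H _ s))) ,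
      not-adjacent (λ s → fj∉H (∈-from-right-quotient fi∈H (S⊆H _ s)))
      where
      not-adjacent : ∀ {b} → ¬ T b → (if b then + 1 else + 0) ≡ + 0
      not-adjacent {false} _  = refl
      not-adjacent {true}  ¬t = ⊥-elim (¬t tt)

lemma2p2 : (n : ℕ) (G : FinGroup n) → CayleyIntegral G →
    (H : Subset n) → IsSubgroup G H → CayleyIntegralOn G H
lemma2p2 n G CI H H≤G S S⊆H e∉S S⁻¹⊆S m f f-inj f∈H f-onto =
  IntegralMatrix-cong (λ i j → cong₂ adjacency (listing-↑ˡ i) (listing-↑ˡ j))
    (IntegralMatrix-upperLeft m r (cayleyAdj G S listing)
      (λ i j → proj₁ (no-edge i j)) (λ i j → proj₂ (no-edge j i))
      (CI S (λ _ _ → tt) e∉S S⁻¹⊆S (m ℕ.+ r) listing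
        (concatElem-injective H? Hₑ Hᶜ) (λ _ → tt) (λ x _ → concatElem-surjective H? Hₑ Hᶜ x)))
  where
  open FinGroup G
  H? : Decidable (T ∘ H)
  H? x = T? (H x)
  Hₑ : Enumeration (T ∘ H)
  Hₑ = record { size = m ; elem = f ; injective = f-inj ; sound = f∈H ; complete = f-onto }
  Hᶜ : Enumeration (¬_ ∘ T ∘ H)
  Hᶜ = enumerate (λ x → ¬? (H? x))
  r : ℕ
  r = Enumeration.size Hᶜ
  listing : Fin (m ℕ.+ r) → Fin n
  listing = concatElem H? Hₑ Hᶜ
  listing-↑ˡ : ∀ i → listing (i ↑ˡ r) ≡ f i
  listing-↑ˡ = concatElem-↑ˡ H? Hₑ Hᶜ
  listing-↑ʳ : ∀ j → listing (m ↑ʳ j) ≡ Enumeration.elem Hᶜ j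
  listing-↑ʳ = concatElem-↑ʳ H? Hₑ Hᶜ
  adjacency : Fin n → Fin n → ℤ
  adjacency x y = if S (x ∙ y ⁻¹) then + 1 else + 0
  no-edge : ∀ i j → cayleyAdj G S listing (i ↑ˡ r) (m ↑ʳ j) ≡ + 0 × cayleyAdj G S listing (m ↑ʳ j) (i ↑ˡ r) ≡ + 0
  no-edge i j = cayleyAdj-leaving G H≤G S⊆H listing (i ↑ˡ r) (m ↑ʳ j)
    (subst (T ∘ H) (sym (listing-↑ˡ i)) (f∈H i))
    (λ t → Enumeration.sound Hᶜ j (subst (T ∘ H) (listing-↑ʳ j) t))
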